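{- Let $M=(E,\mathcal{I})$ be a matroid with $\sigma(M)=\lambda(M)=k$. Then any two distinct minimum cocircuits of $M$ are disjoint.
   Context: $\sigma(M)$ is the largest number of pairwise disjoint bases of $M$. A cocircuit is a minimal subset of $E$ meeting every base; $\lambda(M)$ (cogirth) is the smallest size of a cocircuit, and a minimum cocircuit is a cocircuit of size $\lambda(M)$. -}

module Defs where

open import Data.Nat using (ℕ; suc; _<_)
open import Data.Fin using (Fin)
open import Data.Fin.Subset using (Subset; _∈_; _∉_; _⊆_; ∣_∣; _∪_; ⁅_⁆; ⊥)
open import Data.Product using (Σ; _×_; ∃; ∃-syntax)
open import Relation.Binary.PropositionalEquality using (_≡_)
open import Relation.Nullary using (¬_; Dec)
import Data.Empty as E

-- A (finite) matroid on the ground set E = Fin n, given by its independent sets.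
-- Independence is required to be decidable (automatic classically for a finite ground set).
record Matroid (n : ℕ) : Set₁ where
  field
    Indep     : Subset n → Set
    indep?    : (A : Subset n) → Dec (Indep A)
    indep-∅   : Indep ⊥
    indep-⊆   : ∀ {A B} → A ⊆ B → Indep B → Indep A
    indep-aug : ∀ {A B} → Indep A → Indep B → ∣ A ∣ < ∣ B ∣ →
                ∃[ x ] (x ∈ B × x ∉ A × Indep (⁅ x ⁆ ∪ A))

module _ {n : ℕ} (M : Matroid n) where
  open Matroid M

  IsBase : Subset n → Set
  IsBase B = Indep B × (∀ B′ → Indep B′ → B ⊆ B′ → B′ ≡ B)

  Disjoint : Subset n → Subset n → Set
  Disjoint A B = ∀ x → x ∈ A → x ∈ B → E.⊥

  MeetsAllBases : Subset n → Set
  MeetsAllBases X = ∀ B → IsBase B → ∃[ x ] (x ∈ X × x ∈ B)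

  IsCocircuit : Subset n → Set
  IsCocircuit C = MeetsAllBases C × (∀ D → D ⊆ C → MeetsAllBases D → D ≡ C)

  HasDisjointBases : ℕ → Set
  HasDisjointBases k =
    Σ (Fin k → Subset n) λ Bs →
      (∀ i → IsBase (Bs i)) × (∀ i j → ¬ i ≡ j → Disjoint (Bs i) (Bs j))

  σ≡ : ℕ → Set
  σ≡ k = HasDisjointBases k × ¬ HasDisjointBases (suc k)

  λ≡ : ℕ → Set
  λ≡ k = (∃[ C ] (IsCocircuit C × ∣ C ∣ ≡ k)) × (∀ C → IsCocircuit C → k Data.Nat.≤ ∣ C ∣)

  IsMinCocircuit : ℕ → Subset n → Set
  IsMinCocircuit k C = IsCocircuit C × ∣ C ∣ ≡ k

-- Take k pairwise disjoint bases B₁ … Bₖ. A set of size k meeting every base must pick a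
-- point from each Bᵢ, and these k points are distinct, so a minimum cocircuit meets each Bᵢ
-- in exactly one point and lies inside B₁ ∪ … ∪ Bₖ. Suppose the minimum cocircuits C ≠ D
-- share e ∈ Bᵢ, and take x ∈ C ∖ D. If some base B′ avoided C - x, exchanging e for some
-- y ∈ B′ would give a base (Bᵢ - e) ∪ {y} meeting C and D only in y; hence y ∈ C ∩ B′, so
-- y = x, and then x ∈ D. So C - x meets every base, contradicting the minimality of C.
-- Only σ(M) ≥ k and ∣C∣, ∣D∣ ≤ k are used.
module Submission where

open import Defs
open import Data.Nat using (ℕ; zero; suc; _≤_; _<_; z≤n; s≤s)
open import Data.Nat.Properties using (≤-refl; ≤-reflexive; ≤-trans; <-≤-trans; ≤-<-trans; <-irrefl; n≤1+n; ≰⇒>; _≤?_)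
open import Data.Fin using (Fin; zero; suc; _≟_)
open import Data.Fin.Properties using (any?)
open import Data.Fin.Subset using (Subset; _∈_; _∉_; _⊆_; ∣_∣; _∪_; _∩_; _-_; ⁅_⁆; inside; outside)
open import Data.Fin.Subset.Properties
open import Data.Vec using (_∷_; there)
open import Data.Product using (_×_; ∃; _,_; proj₁; proj₂)
open import Data.Sum using (inj₁; inj₂)
open import Data.Empty using (⊥; ⊥-elim)
open import Function.Definitions using (Injective)
open import Relation.Binary.PropositionalEquality using (_≡_; _≢_; refl; sym; trans; cong; subst; module ≡-Reasoning)
open import Relation.Nullary using (¬_; yes; no; contradiction)
open import Relation.Nullary.Decidable using (_×-dec_; ¬?; decidable-stable)

x∉p-x : ∀ {n} (p : Subset n) x → x ∉ p - x
x∉p-x (_ ∷ p) zero    ()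
x∉p-x (_ ∷ p) (suc x) (there x∈p-x) = x∉p-x p x x∈p-x

∣⁅x⁆∪p∣≤1+∣p∣ : ∀ {n} (x : Fin n) (p : Subset n) → ∣ ⁅ x ⁆ ∪ p ∣ ≤ suc ∣ p ∣
∣⁅x⁆∪p∣≤1+∣p∣ zero    (inside  ∷ p) rewrite ∪-identityˡ p = n≤1+n _
∣⁅x⁆∪p∣≤1+∣p∣ zero    (outside ∷ p) rewrite ∪-identityˡ p = ≤-refl
∣⁅x⁆∪p∣≤1+∣p∣ (suc x) (inside  ∷ p) = s≤s (∣⁅x⁆∪p∣≤1+∣p∣ x p)
∣⁅x⁆∪p∣≤1+∣p∣ (suc x) (outside ∷ p) = ∣⁅x⁆∪p∣≤1+∣p∣ x p

∣p∣≤1+∣p-x∣ : ∀ {n} (p : Subset n) x → ∣ p ∣ ≤ suc ∣ p - x ∣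
∣p∣≤1+∣p-x∣ p x = ≤-trans (p⊆q⇒∣p∣≤∣q∣ p⊆⁅x⁆∪p-x) (∣⁅x⁆∪p∣≤1+∣p∣ x (p - x))
  where
  p⊆⁅x⁆∪p-x : p ⊆ ⁅ x ⁆ ∪ (p - x)
  p⊆⁅x⁆∪p-x {y} y∈p with y ≟ x
  ... | yes refl = x∈p∪q⁺ (inj₁ (x∈⁅x⁆ y))
  ... | no  y≢x  = x∈p∪q⁺ (inj₂ (x∈p∧x≢y⇒x∈p-y y∈p y≢x))

⊈⇒∃∉ : ∀ {n} {p q : Subset n} → ¬ p ⊆ q → ∃ λ x → x ∈ p × x ∉ q
⊈⇒∃∉ {p = p} {q} p⊈q with any? (λ x → (x ∈? p) ×-dec ¬? (x ∈? q))
... | yes witness = witness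
... | no  none    = ⊥-elim (p⊈q λ {x} x∈p → decidable-stable (x ∈? q) (λ x∉q → none (x , x∈p , x∉q)))

∈∩⊆⁅⁆⇒≡ : ∀ {n} {p q : Subset n} {x y} → p ∩ q ⊆ ⁅ x ⁆ → y ∈ p → y ∈ q → y ≡ x
∈∩⊆⁅⁆⇒≡ {x = x} p∩q⊆⁅x⁆ y∈p y∈q = x∈⁅y⁆⇒x≡y x (p∩q⊆⁅x⁆ (x∈p∩q⁺ (y∈p , y∈q)))

∩⊆⁅⁆-exchange : ∀ {n} {p q : Subset n} {x} y → p ∩ q ⊆ ⁅ x ⁆ → (⁅ y ⁆ ∪ (p - x)) ∩ q ⊆ ⁅ y ⁆
∩⊆⁅⁆-exchange {p = p} {q} {x} y p∩q⊆⁅x⁆ {z} z∈J∩q with x∈p∩q⁻ _ q z∈J∩q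
... | z∈J , z∈q with x∈p∪q⁻ ⁅ y ⁆ (p - x) z∈J
...   | inj₁ z∈⁅y⁆ = z∈⁅y⁆
...   | inj₂ z∈p-x = contradiction (subst (_∈ p - x) (∈∩⊆⁅⁆⇒≡ p∩q⊆⁅x⁆ (p─q⊆p p ⁅ x ⁆ z∈p-x) z∈q) z∈p-x) (x∉p-x p x)

injective⇒≤∣∣ : ∀ {k n} {f : Fin k → Fin n} (S : Subset n) →
                Injective _≡_ _≡_ f → (∀ i → f i ∈ S) → k ≤ ∣ S ∣
injective⇒≤∣∣ {zero}          S _   _    = z≤n
injective⇒≤∣∣ {suc k} {f = f} S inj f∈S =
  <-≤-trans (s≤s (injective⇒≤∣∣ (S - f zero) (λ eq → suc-injective (inj eq)) f∘suc∈S-f0))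
            (x∈p⇒∣p-x∣<∣p∣ (f∈S zero))
  where
  open Data.Fin.Properties using (suc-injective; 0≢1+n)
  f∘suc∈S-f0 : ∀ i → f (suc i) ∈ S - f zero
  f∘suc∈S-f0 i = x∈p∧x≢y⇒x∈p-y (f∈S (suc i)) (λ eq → 0≢1+n (sym (inj eq)))

module _ {n : ℕ} (M : Matroid n) where
  open Matroid M

  ∣indep∣≤∣base∣ : ∀ {A B} → Indep A → IsBase M B → ∣ A ∣ ≤ ∣ B ∣
  ∣indep∣≤∣base∣ {A} {B} indA (indB , maxB) with ∣ A ∣ ≤? ∣ B ∣
  ... | yes ∣A∣≤∣B∣ = ∣A∣≤∣B∣
  ... | no  ∣A∣≰∣B∣ with indep-aug indB indA (≰⇒> ∣A∣≰∣B∣)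
  ...   | x , _ , x∉B , indx∪B =
          contradiction (subst (x ∈_) (maxB _ indx∪B (q⊆p∪q ⁅ x ⁆ B)) (x∈p∪q⁺ (inj₁ (x∈⁅x⁆ x)))) x∉B

  indep∧∣base∣≤⇒base : ∀ {A B} → Indep A → IsBase M B → ∣ B ∣ ≤ ∣ A ∣ → IsBase M A
  indep∧∣base∣≤⇒base {A} {B} indA baseB ∣B∣≤∣A∣ = indA , maximal
    where
    maximal : ∀ A′ → Indep A′ → A ⊆ A′ → A′ ≡ A
    maximal A′ indA′ A⊆A′ with A′ ⊆? A
    ... | yes A′⊆A = ⊆-antisym A′⊆A A⊆A′
    ... | no  A′⊈A = ⊥-elim (<-irrefl refl (≤-<-trans (≤-trans (∣indep∣≤∣base∣ indA′ baseB) ∣B∣≤∣A∣) ∣A∣<∣A′∣))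
      where
      ∣A∣<∣A′∣ : ∣ A ∣ < ∣ A′ ∣
      ∣A∣<∣A′∣ = p⊂q⇒∣p∣<∣q∣ (A⊆A′ , ⊈⇒∃∉ A′⊈A)

  base-exchange : ∀ {B B′ e} → IsBase M B → e ∈ B → IsBase M B′ →
                  ∃ λ y → y ∈ B′ × IsBase M (⁅ y ⁆ ∪ (B - e))
  base-exchange {B} {B′} {e} baseB@(indB , _) e∈B baseB′
    with indep-aug (indep-⊆ (p─q⊆p B ⁅ e ⁆) indB) (proj₁ baseB′)
                   (<-≤-trans (x∈p⇒∣p-x∣<∣p∣ e∈B) (∣indep∣≤∣base∣ indB baseB′))
  ... | y , y∈B′ , y∉B-e , indJ = y , y∈B′ , indep∧∣base∣≤⇒base indJ baseB ∣B∣≤∣J∣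
    where
    ∣B-e∣<∣J∣ : ∣ B - e ∣ < ∣ ⁅ y ⁆ ∪ (B - e) ∣
    ∣B-e∣<∣J∣ = p⊂q⇒∣p∣<∣q∣ (q⊆p∪q ⁅ y ⁆ (B - e) , y , x∈p∪q⁺ (inj₁ (x∈⁅x⁆ y)) , y∉B-e)
    ∣B∣≤∣J∣ : ∣ B ∣ ≤ ∣ ⁅ y ⁆ ∪ (B - e) ∣
    ∣B∣≤∣J∣ = ≤-trans (∣p∣≤1+∣p-x∣ B e) ∣B-e∣<∣J∣

  cocircuit-minimal : ∀ {C x} → IsCocircuit M C → x ∈ C → ¬ MeetsAllBases M (C - x)
  cocircuit-minimal {C} {x} (_ , minC) x∈C meetsC-x =
    x∉p-x C x (subst (x ∈_) (sym (minC (C - x) (p─q⊆p C ⁅ x ⁆) meetsC-x)) x∈C)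

  module _ {B C D e} (baseB : IsBase M B) (e∈B : e ∈ B) (B∩C⊆⁅e⁆ : B ∩ C ⊆ ⁅ e ⁆) (B∩D⊆⁅e⁆ : B ∩ D ⊆ ⁅ e ⁆)
           (meetsC : MeetsAllBases M C) (meetsD : MeetsAllBases M D) where

    base∩C⊆⁅x⁆⇒¬x∉D : ∀ {B′ x} → IsBase M B′ → B′ ∩ C ⊆ ⁅ x ⁆ → x ∉ D → ⊥
    base∩C⊆⁅x⁆⇒¬x∉D {B′} {x} baseB′ B′∩C⊆⁅x⁆ x∉D with base-exchange baseB e∈B baseB′
    ... | y , y∈B′ , baseJ with meetsC _ baseJ | meetsD _ baseJ
    ...   | c , c∈C , c∈J | d , d∈D , d∈J = x∉D (subst (_∈ D) d≡x d∈D)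
      where
      c≡y : c ≡ y
      c≡y = ∈∩⊆⁅⁆⇒≡ (∩⊆⁅⁆-exchange y B∩C⊆⁅e⁆) c∈J c∈C
      d≡x : d ≡ x
      d≡x = trans (∈∩⊆⁅⁆⇒≡ (∩⊆⁅⁆-exchange y B∩D⊆⁅e⁆) d∈J d∈D)
                  (∈∩⊆⁅⁆⇒≡ B′∩C⊆⁅x⁆ y∈B′ (subst (_∈ C) c≡y c∈C))

    ∉⇒meetsAllBases-x : ∀ {x} → x ∉ D → MeetsAllBases M (C - x)
    ∉⇒meetsAllBases-x {x} x∉D B′ baseB′ with any? (λ z → (z ∈? C - x) ×-dec (z ∈? B′))
    ... | yes meets = meets
    ... | no  avoids = ⊥-elim (base∩C⊆⁅x⁆⇒¬x∉D baseB′ B′∩C⊆⁅x⁆ x∉D)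
      where
      B′∩C⊆⁅x⁆ : B′ ∩ C ⊆ ⁅ x ⁆
      B′∩C⊆⁅x⁆ {z} z∈B′∩C with z ≟ x | x∈p∩q⁻ B′ C z∈B′∩C
      ... | yes refl | _           = x∈⁅x⁆ z
      ... | no  z≢x  | z∈B′ , z∈C = ⊥-elim (avoids (z , x∈p∧x≢y⇒x∈p-y z∈C z≢x , z∈B′))

  module DisjointBases {k} (Bs : Fin k → Subset n) (baseBs : ∀ i → IsBase M (Bs i))
                       (disjoint : ∀ i j → i ≢ j → Disjoint M (Bs i) (Bs j)) where

    index-unique : ∀ {x i j} → x ∈ Bs i → x ∈ Bs j → i ≡ j
    index-unique {x} {i} {j} x∈Bsi x∈Bsj with i ≟ j
    ... | yes i≡j = i≡j
    ... | no  i≢j = ⊥-elim (disjoint i j i≢j x x∈Bsi x∈Bsj)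

    module Transversal {X} (meetsX : MeetsAllBases M X) (∣X∣≤k : ∣ X ∣ ≤ k) where

      pick : Fin k → Fin n
      pick i = proj₁ (meetsX (Bs i) (baseBs i))

      pick∈X : ∀ i → pick i ∈ X
      pick∈X i = proj₁ (proj₂ (meetsX (Bs i) (baseBs i)))

      pick∈Bs : ∀ i → pick i ∈ Bs i
      pick∈Bs i = proj₂ (proj₂ (meetsX (Bs i) (baseBs i)))

      pick-injective : Injective _≡_ _≡_ pick
      pick-injective {i} {j} pick-i≡pick-j = index-unique (pick∈Bs i) (subst (_∈ Bs j) (sym pick-i≡pick-j) (pick∈Bs j))

      pick-surjective : ∀ {y} → y ∈ X → ∃ λ i → pick i ≡ y
      pick-surjective {y} y∈X with any? (λ i → pick i ≟ y)
      ... | yes hit = hit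
      ... | no  miss = ⊥-elim (<-irrefl refl (<-≤-trans (≤-<-trans k≤∣X-y∣ (x∈p⇒∣p-x∣<∣p∣ y∈X)) ∣X∣≤k))
        where
        k≤∣X-y∣ : k ≤ ∣ X - y ∣
        k≤∣X-y∣ = injective⇒≤∣∣ (X - y) pick-injective (λ i → x∈p∧x≢y⇒x∈p-y (pick∈X i) (λ eq → miss (i , eq)))

      ∈⇒∃Bs : ∀ {y} → y ∈ X → ∃ λ i → y ∈ Bs i
      ∈⇒∃Bs y∈X with pick-surjective y∈X
      ... | i , pick-i≡y = i , subst (_∈ Bs i) pick-i≡y (pick∈Bs i)

      Bs∩X⊆⁅⁆ : ∀ {e i} → e ∈ X → e ∈ Bs i → Bs i ∩ X ⊆ ⁅ e ⁆
      Bs∩X⊆⁅⁆ {e} {i} e∈X e∈Bsi {z} z∈Bsi∩X with x∈p∩q⁻ (Bs i) X z∈Bsi∩X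
      ... | z∈Bsi , z∈X with pick-surjective z∈X | pick-surjective e∈X
      ...   | j , pick-j≡z | j′ , pick-j′≡e = subst (_∈ ⁅ e ⁆) (sym z≡e) (x∈⁅x⁆ e)
        where
        open ≡-Reasoning
        z≡e : z ≡ e
        z≡e = begin
          z       ≡⟨ sym pick-j≡z ⟩
          pick j  ≡⟨ cong pick (index-unique (subst (_∈ Bs j) pick-j≡z (pick∈Bs j)) z∈Bsi) ⟩
          pick i  ≡⟨ cong pick (index-unique e∈Bsi (subst (_∈ Bs j′) pick-j′≡e (pick∈Bs j′))) ⟩
          pick j′ ≡⟨ pick-j′≡e ⟩
          e       ∎

    cocircuit-⊆-of-common-point : ∀ {C D e} → IsCocircuit M C → MeetsAllBases M D → ∣ C ∣ ≤ k → ∣ D ∣ ≤ k →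
                                  e ∈ C → e ∈ D → C ⊆ D
    cocircuit-⊆-of-common-point {C} {D} {e} cocircC@(meetsC , _) meetsD ∣C∣≤k ∣D∣≤k e∈C e∈D with C ⊆? D
    ... | yes C⊆D = C⊆D
    ... | no  C⊈D = ⊥-elim (impossible (⊈⇒∃∉ C⊈D) (TC.∈⇒∃Bs e∈C))
      where
      module TC = Transversal meetsC ∣C∣≤k
      module TD = Transversal meetsD ∣D∣≤k
      impossible : (∃ λ x → x ∈ C × x ∉ D) → (∃ λ i → e ∈ Bs i) → ⊥
      impossible (x , x∈C , x∉D) (i , e∈Bsi) = cocircuit-minimal cocircC x∈C
        (∉⇒meetsAllBases-x (baseBs i) e∈Bsi (TC.Bs∩X⊆⁅⁆ e∈C e∈Bsi) (TD.Bs∩X⊆⁅⁆ e∈D e∈Bsi) meetsC meetsD x∉D)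

lemma1p7 : ∀ {n} (M : Matroid n) (k : ℕ) → σ≡ M k → λ≡ M k →
    ∀ (C D : Subset n) → IsMinCocircuit M k C → IsMinCocircuit M k D →
    ¬ C ≡ D → Disjoint M C D
lemma1p7 M k ((Bs , baseBs , disjoint) , _) _ C D (cocircC , ∣C∣≡k) ((meetsD , minD) , ∣D∣≡k) C≢D e e∈C e∈D =
  C≢D (minD C C⊆D (proj₁ cocircC))
  where
  open DisjointBases M Bs baseBs disjoint
  C⊆D : C ⊆ D
  C⊆D = cocircuit-⊆-of-common-point cocircC meetsD (≤-reflexive ∣C∣≡k) (≤-reflexive ∣D∣≡k) e∈C e∈D
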